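{- For every finite set $I$, the tensor product functor $\bigotimes$ from $\mathsf{Fin}^I$ to $\mathsf{Fin}$ is directly continuous.
   Context: Finiteness spaces $\mathcal A=(|\mathcal A|,\mathfrak F(\mathcal A))$: a set with $\mathfrak F(\mathcal A)\subseteq\mathcal P(|\mathcal A|)$ equal to its bidual, where $\mathfrak A^\perp=\{a': a\cap a'\text{ finite }\forall a\in\mathfrak A\}$. The tensor product of a family $(\mathcal A_i)_{i\in I}$ is $\bigotimes_i\mathcal A_i$ with web $\prod_i|\mathcal A_i|$ and finitary subsets those $\hat a\subseteq\prod_i|\mathcal A_i|$ such that $\mathrm{proj}_i[\hat a]\in\mathfrak F(\mathcal A_i)$ for every $i$, where $\mathrm{proj}_i[\hat a]=\{\alpha_i:\vec\alpha\in\hat a\}$; on a family of relations $f_i\subseteq A_i\times B_i$, $\bigotimes\vec f=\{(\vec\alpha,\vec\beta):\forall i,\ (\alpha_i,\beta_i)\in f_i\}$ (for finite $I$ this is a functor from $\mathsf{Fin}^I$ to $\mathsf{Fin}$, the category of finiteness spaces and finitary relations). Finiteness inclusion: $\mathcal A\sqsubseteq\mathcal B$ iff $|\mathcal A|\subseteq|\mathcal B|$ and $\mathfrak F(\mathcal A)\subseteq\mathfrak F(\mathcal B)$; the supremum $\bigsqcup_j\mathcal A_j$ of a family has web $\bigcup_j|\mathcal A_j|$ and structure $(\bigcup_j\mathfrak F(\mathcal A_j))^{\perp\perp}$ (preduals on the union web). A functor $\mathcal T$ from $\mathsf{Fin}^I$ to $\mathsf{Fin}$ is directly continuous if it is $\sqsubseteq$-monotonic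 and, for every family $((\mathcal A_{i,j})_{j\in J_i})_{i\in I}$ with each $(\mathcal A_{i,j})_{j\in J_i}$ directed for $\sqsubseteq$, $\mathcal T(\bigsqcup_{j\in J_i}\mathcal A_{i,j})_{i\in I}=\bigsqcup_{\vec j\in\prod_iJ_i}\mathcal T(\mathcal A_{i,j_i})_{i\in I}$. -}

module Defs where

open import Level using (Level; 0ℓ) renaming (suc to lsuc)
open import Data.Nat using (ℕ)
open import Data.Fin using (Fin)
open import Data.List using (List)
open import Data.List.Membership.Propositional using (_∈_)
open import Data.Product using (Σ; ∃; _×_; _,_; proj₁)
open import Relation.Binary.PropositionalEquality using (_≡_)

-- Subsets of an ambient type X (webs are subsets of X; all webs that are
-- compared by ⊑ / joined by ⊔ live in the same ambient type).
Subset : Set → Set₁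
Subset X = X → Set

_⊆_ : {X : Set} → Subset X → Subset X → Set
a ⊆ b = ∀ x → a x → b x

_∩_ : {X : Set} → Subset X → Subset X → Subset X
(a ∩ b) x = a x × b x

Finite : {X : Set} → Subset X → Set
Finite {X} a = Σ (List X) λ xs → ∀ x → a x → x ∈ xs

Family : Set → Set₂
Family X = Subset X → Set₁

Orth : {X : Set} → Subset X → Family X → Family X
Orth W 𝔄 a' = (a' ⊆ W) × (∀ a → 𝔄 a → Finite (a ∩ a'))

record Space (X : Set) : Set₂ where
  constructor space
  field
    web : Subset X
    fin : Family X
open Space public

IsFinSp : {X : Set} → Space X → Set₁
IsFinSp A =
  (∀ a → fin A a → Orth (web A) (Orth (web A) (fin A)) a) ×
  (∀ a → Orth (web A) (Orth (web A) (fin A)) a → fin A a)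

FinSp : Set → Set₂
FinSp X = Σ (Space X) IsFinSp

∣_∣ : {X : Set} → FinSp X → Space X
∣ A ∣ = proj₁ A

_⊑_ : {X : Set} → Space X → Space X → Set₁
A ⊑ B = (web A ⊆ web B) × (∀ a → fin A a → fin B a)

_≅_ : {X : Set} → Space X → Space X → Set₁
A ≅ B = (A ⊑ B) × (B ⊑ A)

⨆ : {X : Set} {J : Set} → (J → Space X) → Space X
⨆ {J = J} A = space W (Orth W (Orth W (λ a → Σ J λ j → fin (A j) a)))
  where
  W : Subset _
  W x = Σ J λ j → web (A j) x

Directed : {X : Set} {J : Set} → (J → FinSp X) → Set₁
Directed {J = J} A =
  Level.Lift (lsuc 0ℓ) J ×
  (∀ j k → Σ J λ l → (∣ A j ∣ ⊑ ∣ A l ∣) × (∣ A k ∣ ⊑ ∣ A l ∣))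

proj : {n : ℕ} {X : Fin n → Set} → (i : Fin n) →
       Subset ((k : Fin n) → X k) → Subset (X i)
proj i â x = Σ _ λ α → â α × (α i ≡ x)

⨂ : {n : ℕ} {X : Fin n → Set} → ((i : Fin n) → Space (X i)) →
    Space ((i : Fin n) → X i)
⨂ A = space W F
  where
  W : Subset _
  W α = ∀ i → web (A i) (α i)
  F : Family _
  F â = (â ⊆ W) × (∀ i → fin (A i) (proj i â))

module Submission where

-- The tensor product of finitely many finiteness spaces is directly
-- continuous.
--
-- For the continuity
-- equation the webs agree by reshuffling witnesses, and the structures are
-- compared via two facts about biduals along an arbitrary map f : Y → Z:
--   * image-bidual:    f-images of U-sets lying in G  ⇒  f[U^⊥⊥] ⊆ G^⊥⊥;
--   * preimage-bidual: if a set R meets f⁻¹[c] finitely for every c ∈ G (and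
--     G contains the singletons of its web), the same holds for c ∈ G^⊥⊥.
-- Applied to the coordinate projections, image-bidual shows that every
-- coordinate of a finitary set of ⨆_js ⨂_i A(i, js i) is finitary in
-- ⨆_j A(i, j). Conversely, for b' orthogonal to all ⨂_i A(i, js i), boxes
-- whose sides lie in ⋃_j 𝔉(A(i, j)) meet b' finitely; applying
-- preimage-bidual to one coordinate after the other upgrades the sides to
-- the biduals, which covers every finitary set of ⨂_i ⨆_j A(i, j).
-- Excluded middle chooses preimages and decides web membership.

open import Defs
open import Level using (Level; 0ℓ; lift; lower) renaming (suc to lsuc)
open import Axiom.ExcludedMiddle using (ExcludedMiddle)
open import Data.Nat using (ℕ; zero; suc; _<_; _≤_; z≤n; s≤s)
open import Data.Nat.Properties using (≤-refl; ≤-reflexive; <⇒≤; m<n⇒m<1+n; <-irrefl; <⇒≱; ≤∧≢⇒<)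
open import Data.Fin using (Fin; toℕ; fromℕ<)
open import Data.Fin.Properties using (_≟_; toℕ<n; toℕ-fromℕ<; toℕ-injective)
open import Data.List using (List; []; _∷_; map; mapMaybe; concatMap)
open import Data.List.Membership.Propositional using (_∈_)
open import Data.List.Membership.Propositional.Properties using (∈-map⁺; ∈-concatMap⁺)
open import Data.List.Relation.Unary.Any as Any using ()
open import Data.List.Relation.Unary.Any.Properties using (map⁺; mapMaybe⁺)
open import Data.Maybe using (Maybe; just; nothing)
open import Data.Maybe.Relation.Unary.Any as MaybeAny using ()
open import Data.Product using (Σ; _×_; _,_; proj₁; proj₂)
open import Data.Empty using (⊥-elim)
open import Relation.Nullary using (Dec; yes; no)
open import Relation.Nullary.Decidable using (map′)
open import Relation.Binary.PropositionalEquality using (_≡_; _≢_; refl; sym; trans)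

lowerEM : ExcludedMiddle (lsuc 0ℓ) → ExcludedMiddle 0ℓ
lowerEM em = map′ lower lift em

Image : {Y Z : Set} → (Y → Z) → Subset Y → Subset Z
Image {Y} f a z = Σ Y λ y → a y × f y ≡ z

Preimage : {Y Z : Set} → (Y → Z) → Subset Z → Subset Y
Preimage f c y = c (f y)

Bidual : {X : Set} → Subset X → Family X → Family X
Bidual W 𝔄 = Orth W (Orth W 𝔄)

Finite-mono : {X : Set} {a b : Subset X} → a ⊆ b → Finite b → Finite a
Finite-mono a⊆b (xs , cover) = xs , λ x ax → cover x (a⊆b x ax)

Finite-image : {Y Z : Set} (f : Y → Z) {a : Subset Y} → Finite a → Finite (Image f a)
Finite-image f (ys , cover) = map f ys , λ { z (y , ay , refl) → ∈-map⁺ f (cover y ay) }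

Finite-⋃ : {Y Z : Set} (zs : List Z) (a : Z → Subset Y) → (∀ z → Finite (a z)) →
           Finite (λ y → Σ Z λ z → z ∈ zs × a z y)
Finite-⋃ zs a finite =
  concatMap (λ z → proj₁ (finite z)) zs ,
  λ { y (z , z∈zs , azy) →
        ∈-concatMap⁺ (λ z → proj₁ (finite z)) (Any.map (λ { refl → proj₂ (finite z) y azy }) z∈zs) }

record Section {Y Z : Set} (f : Y → Z) (a : Subset Y) : Set where
  field
    pick       : Z → Maybe Y
    pick-sound : ∀ {z y} → pick z ≡ just y → a y × f y ≡ z
    pick-total : ∀ {z} → Image f a z → Σ Y λ y → pick z ≡ just y

section : ExcludedMiddle 0ℓ → {Y Z : Set} (f : Y → Z) (a : Subset Y) → Section f a
section em {Y} f a = record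
  { pick = λ z → choose em
  ; pick-sound = λ {z} → choose-sound em
  ; pick-total = λ {z} → choose-total em
  }
  where
  choose : ∀ {z} → Dec (Image f a z) → Maybe Y
  choose (yes (y , _)) = just y
  choose (no _) = nothing

  choose-sound : ∀ {z y} (d : Dec (Image f a z)) → choose d ≡ just y → a y × f y ≡ z
  choose-sound (yes (y , ay , fy≡z)) refl = ay , fy≡z

  choose-total : ∀ {z} (d : Dec (Image f a z)) → Image f a z → Σ Y λ y → choose d ≡ just y
  choose-total (yes (y , _)) _ = y , refl
  choose-total (no ∉image) ∈image = ⊥-elim (∉image ∈image)

Finite-section : {Y Z : Set} (f : Y → Z) (pick : Z → Maybe Y) {a : Subset Y} →
                 (∀ y → a y → pick (f y) ≡ just y) → Finite (Image f a) → Finite a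
Finite-section f pick picked (zs , cover) =
  mapMaybe pick zs ,
  λ y ay → mapMaybe⁺ pick zs
             (map⁺ (Any.map (λ { refl → just-∈ (picked y ay) }) (cover (f y) (y , ay , refl))))
  where
  just-∈ : ∀ {m y} → m ≡ just y → MaybeAny.Any (y ≡_) m
  just-∈ refl = MaybeAny.just refl

image-bidual : ExcludedMiddle 0ℓ → {Y Z : Set} (f : Y → Z)
               {W : Subset Y} {U : Family Y} {V : Subset Z} {G : Family Z} →
               (∀ c → U c → G (Image f c)) →
               ∀ a → Bidual W U a → Image f a ⊆ V → Bidual V G (Image f a)
image-bidual em {Y} f {W} {U} {V} {G} push a (a⊆W , a⊥⊥) fa⊆V = fa⊆V , orthogonal
  where
  open Section (section em f a)

  orthogonal : ∀ a' → Orth V G a' → Finite (a' ∩ Image f a)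
  orthogonal a' (_ , a'⊥) = Finite-mono through-chosen (Finite-image f (a⊥⊥ chosen chosen⊥))
    where
    chosen : Subset Y
    chosen y = a' (f y) × pick (f y) ≡ just y

    chosen⊥ : Orth W U chosen
    chosen⊥ =
      (λ y (_ , picked) → a⊆W y (proj₁ (pick-sound picked))) ,
      λ c Uc → Finite-section f pick (λ y (_ , _ , picked) → picked)
                 (Finite-mono (λ { z (y , (cy , a'z , _) , refl) → (y , cy , refl) , a'z })
                   (a'⊥ (Image f c) (push c Uc)))

    through-chosen : (a' ∩ Image f a) ⊆ Image f (chosen ∩ a)
    through-chosen z (a'z , fa-z) with pick-total fa-z
    ... | y , picked with pick-sound picked
    ...   | ay , refl = y , ((a'z , picked) , ay) , refl

preimage-bidual : ExcludedMiddle 0ℓ → {Y Z : Set} (f : Y → Z) (R : Subset Y)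
                  {V : Subset Z} {G : Family Z} →
                  (∀ z → V z → G (_≡ z)) →
                  (∀ c → G c → Finite (R ∩ Preimage f c)) →
                  ∀ c → Bidual V G c → Finite (R ∩ Preimage f c)
preimage-bidual em {Y} {Z} f R {V} {G} singleton fibre c (c⊆V , c⊥⊥) =
  Finite-mono cover (Finite-⋃ (proj₁ hit) slice slice-finite)
  where
  values : Subset Z
  values z = V z × Image f R z

  values⊥ : Orth V G values
  values⊥ =
    (λ _ → proj₁) ,
    λ c' Gc' → Finite-mono (λ { z (c'z , _ , y , Ry , refl) → y , (Ry , c'z) , refl })
                 (Finite-image f (fibre c' Gc'))

  hit : Finite (values ∩ c)
  hit = c⊥⊥ values values⊥

  slice : Z → Subset Y
  slice z y = V z × (R ∩ Preimage f (_≡ z)) y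

  slice-finite : ∀ z → Finite (slice z)
  slice-finite z with em {V z}
  ... | yes Vz = Finite-mono (λ _ → proj₂) (fibre (_≡ z) (singleton z Vz))
  ... | no ¬Vz = [] , λ y slice-y → ⊥-elim (¬Vz (proj₁ slice-y))

  cover : (R ∩ Preimage f c) ⊆ (λ y → Σ Z λ z → z ∈ proj₁ hit × slice z y)
  cover y (Ry , c-fy) =
    f y , proj₂ hit (f y) ((V-fy , y , Ry , refl) , c-fy) , V-fy , Ry , refl
    where
    V-fy = c⊆V (f y) c-fy

module FinSpFacts {X : Set} (A : FinSp X) where

  fin⊆web : ∀ {a} → fin ∣ A ∣ a → a ⊆ web ∣ A ∣
  fin⊆web fa = proj₁ (proj₁ (proj₂ A) _ fa)

  down : ∀ {a b} → fin ∣ A ∣ a → b ⊆ a → fin ∣ A ∣ b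
  down {a} {b} fa b⊆a = proj₂ (proj₂ A) b
    ((λ x bx → fin⊆web fa x (b⊆a x bx)) ,
     λ a' a'⊥ → Finite-mono (λ x (a'x , bx) → a'x , b⊆a x bx) (proj₂ (proj₁ (proj₂ A) a fa) a' a'⊥))

  singleton : ∀ {x} → web ∣ A ∣ x → fin ∣ A ∣ (_≡ x)
  singleton {x} wx = proj₂ (proj₂ A) _
    ((λ { _ refl → wx }) , λ _ _ → x ∷ [] , λ _ (_ , y≡x) → Any.here y≡x)

open FinSpFacts

box : {n : ℕ} {X : Fin n → Set} → ((k : Fin n) → Subset (X k)) → Subset ((k : Fin n) → X k)
box s α = ∀ k → s k (α k)

upd : {n : ℕ} {X : Fin n → Set} (i : Fin n) → Subset (X i) →
      ((k : Fin n) → Subset (X k)) → (k : Fin n) → Subset (X k)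
upd i c s k with k ≟ i
... | yes refl = c
... | no _ = s k

upd-elim : {ℓ : Level} {n : ℕ} {X : Fin n → Set} (i : Fin n) (c : Subset (X i))
           (s : (k : Fin n) → Subset (X k)) (P : (k : Fin n) → Subset (X k) → Set ℓ) →
           P i c → (∀ k → k ≢ i → P k (s k)) → ∀ k → P k (upd i c s k)
upd-elim i c s P Pc Ps k with k ≟ i
... | yes refl = Pc
... | no k≢i = Ps k k≢i

box-fin : {n : ℕ} {X : Fin n → Set} (A : (k : Fin n) → FinSp (X k)) (s : (k : Fin n) → Subset (X k)) →
          (∀ k → fin ∣ A k ∣ (s k)) → fin (⨂ (λ k → ∣ A k ∣)) (box s)
box-fin A s fs =
  (λ α bα k → fin⊆web (A k) (fs k) (α k) (bα k)) ,
  λ k → down (A k) (fs k) (λ { _ (α , bα , refl) → bα k })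

⨂-mono : {n : ℕ} {X : Fin n → Set} {A B : (i : Fin n) → Space (X i)} →
         (∀ i → A i ⊑ B i) → ⨂ A ⊑ ⨂ B
⨂-mono A⊑B =
  (λ α wα i → proj₁ (A⊑B i) (α i) (wα i)) ,
  λ â (â⊆W , finâ) → (λ α âα i → proj₁ (A⊑B i) (α i) (â⊆W α âα i)) ,
                     λ i → proj₂ (A⊑B i) _ (finâ i)

module TensorOfSup (em : ExcludedMiddle 0ℓ) {n : ℕ} {X : Fin n → Set} {J : Fin n → Set}
                   (A : (i : Fin n) → J i → FinSp (X i)) where

  Π : Set
  Π = (k : Fin n) → X k

  W : (i : Fin n) → Subset (X i)
  W i x = Σ (J i) λ j → web ∣ A i j ∣ x

  F : (i : Fin n) → Family (X i)
  F i a = Σ (J i) λ j → fin ∣ A i j ∣ a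

  W⊗ : Subset Π
  W⊗ α = Σ ((i : Fin n) → J i) λ js → ∀ i → web ∣ A i (js i) ∣ (α i)

  U : Family Π
  U â = Σ ((i : Fin n) → J i) λ js → fin (⨂ (λ i → ∣ A i (js i) ∣)) â

  singleton-F : ∀ i x → W i x → F i (_≡ x)
  singleton-F i x (j , wx) = j , singleton (A i j) wx

  proj-bidual : ∀ â → Bidual W⊗ U â → ∀ i → Bidual (W i) (F i) (proj i â)
  proj-bidual â hâ i =
    image-bidual em (λ α → α i) (λ { ĉ (js , _ , fin-ĉ) → js i , fin-ĉ i }) â hâ
      (λ { _ (α , âα , refl) → proj₁ (proj₁ hâ α âα) i , proj₂ (proj₁ hâ α âα) i })

  module BoxOrth (b' : Subset Π) (b'⊥ : Orth W⊗ U b') where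

    Good : ℕ → Set₁
    Good m = ∀ s → (∀ k → toℕ k < m → Bidual (W k) (F k) (s k)) →
             (∀ k → m ≤ toℕ k → F k (s k)) → Finite (box s ∩ b')

    good-zero : Good 0
    good-zero s _ inF = proj₂ b'⊥ (box s) (js , box-fin (λ k → A k (js k)) s (λ k → proj₂ (inF k z≤n)))
      where
      js : (k : Fin n) → J k
      js k = proj₁ (inF k z≤n)

    -- upgrade side i = m from ⋃_j 𝔉(A(i, j)) to its bidual by preimage-bidual
    good-suc : ∀ m (m<n : m < n) → Good m → Good (suc m)
    good-suc m m<n good s inBidual inF =
      Finite-mono (λ α (bα , b'α) → ((λ k _ → bα k) , b'α) , bα i)
        (preimage-bidual em (λ α → α i) others (singleton-F i) fibre (s i)
          (inBidual i (s≤s (≤-reflexive toℕi≡m))))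
      where
      i : Fin n
      i = fromℕ< m<n

      toℕi≡m : toℕ i ≡ m
      toℕi≡m = toℕ-fromℕ< m<n

      others : Subset Π
      others α = (∀ k → k ≢ i → s k (α k)) × b' α

      beyond-i : ∀ k → k ≢ i → m ≤ toℕ k → suc m ≤ toℕ k
      beyond-i k k≢i m≤k = ≤∧≢⇒< m≤k (λ m≡k → k≢i (toℕ-injective (trans (sym m≡k) (sym toℕi≡m))))

      fibre : ∀ c → F i c → Finite (others ∩ Preimage (λ α → α i) c)
      fibre c Fc =
        Finite-mono (λ α ((s-α , b'α) , cα) → upd-elim i c s (λ k t → t (α k)) cα s-α , b'α)
          (good (upd i c s)
            (upd-elim i c s (λ k t → toℕ k < m → Bidual (W k) (F k) t)
              (λ i<m → ⊥-elim (<-irrefl toℕi≡m i<m))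
              (λ k _ k<m → inBidual k (m<n⇒m<1+n k<m)))
            (upd-elim i c s (λ k t → m ≤ toℕ k → F k t)
              (λ _ → Fc)
              (λ k k≢i m≤k → inF k (beyond-i k k≢i m≤k))))

    good : ∀ m → m ≤ n → Good m
    good zero _ = good-zero
    good (suc m) m<n = good-suc m m<n (good m (<⇒≤ m<n))

    box-orth : ∀ s → (∀ k → Bidual (W k) (F k) (s k)) → Finite (box s ∩ b')
    box-orth s bidual = good n ≤-refl s (λ k _ → bidual k) (λ k n≤k → ⊥-elim (<⇒≱ (toℕ<n k) n≤k))

  tensor⊑sup : ⨂ (λ i → ⨆ (λ j → ∣ A i j ∣)) ⊑ ⨆ (λ js → ⨂ (λ i → ∣ A i (js i) ∣))
  tensor⊑sup =
    (λ α w → (λ i → proj₁ (w i)) , λ i → proj₂ (w i)) ,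
    λ â (â⊆W , proj-fin) →
      (λ α âα → (λ i → proj₁ (â⊆W α âα i)) , λ i → proj₂ (â⊆W α âα i)) ,
      λ b' b'⊥ → Finite-mono (λ α (b'α , âα) → (λ k → α , âα , refl) , b'α)
                   (BoxOrth.box-orth b' b'⊥ (λ k → proj k â) proj-fin)

  sup⊑tensor : ⨆ (λ js → ⨂ (λ i → ∣ A i (js i) ∣)) ⊑ ⨂ (λ i → ⨆ (λ j → ∣ A i j ∣))
  sup⊑tensor =
    (λ α (js , w) i → js i , w i) ,
    λ â hâ → (λ α âα i → proj₁ (proj₁ hâ α âα) i , proj₂ (proj₁ hâ α âα) i) ,
             proj-bidual â hâ

lemma13 : ExcludedMiddle (lsuc 0ℓ) →
    (n : ℕ) (X : Fin n → Set) →
    ((A B : (i : Fin n) → FinSp (X i)) →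
    (∀ i → ∣ A i ∣ ⊑ ∣ B i ∣) →
    ⨂ (λ i → ∣ A i ∣) ⊑ ⨂ (λ i → ∣ B i ∣))
    ×
    ((J : Fin n → Set) (A : (i : Fin n) → J i → FinSp (X i)) →
    (∀ i → Directed (A i)) →
    ⨂ (λ i → ⨆ (λ j → ∣ A i j ∣))
    ≅ ⨆ {J = (i : Fin n) → J i} (λ js → ⨂ (λ i → ∣ A i (js i) ∣)))
lemma13 em n X =
  (λ A B → ⨂-mono) ,
  λ J A _ → let open TensorOfSup (lowerEM em) A in tensor⊑sup , sup⊑tensor
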